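{- Let $G$ be a graph with maximum degree $d$ and $\mathcal{F}$ a family of vertex subsets of $G$, each member of $\mathcal{F}$ containing at least $k$ vertices. If $6|\mathcal{F}| \le e^{k/(6d)}$, then there exists an independent set of $G$ that intersects all sets in $\mathcal{F}$. -}

module Defs where

open import Data.Nat using (ℕ; zero; suc; _+_; _*_; _∸_; _^_; _≤_; _!)
open import Data.Nat.Combinatorics using (_P_)
open import Data.List using (List; map; upTo)
open import Data.Nat.ListAction using (sum)
open import Data.Bool using (Bool; true; false)
open import Data.Fin using (Fin)
open import Data.Fin.Subset using (Subset; _∈_; ∣_∣)
open import Data.Vec using (tabulate)
open import Data.Product using (∃; _×_)
open import Relation.Binary.PropositionalEquality using (_≡_)

record Graph (n : ℕ) : Set where
  field
    adj   : Fin n → Fin n → Bool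
    sym   : ∀ u v → adj u v ≡ adj v u
    irref : ∀ v → adj v v ≡ false

open Graph public

neighbours : ∀ {n} → Graph n → Fin n → Subset n
neighbours G v = tabulate (adj G v)

degree : ∀ {n} → Graph n → Fin n → ℕ
degree G v = ∣ neighbours G v ∣

MaxDegree≤ : ∀ {n} → Graph n → ℕ → Set
MaxDegree≤ G d = ∀ v → degree G v ≤ d

Independent : ∀ {n} → Graph n → Subset n → Set
Independent G I = ∀ u v → u ∈ I → v ∈ I → adj G u v ≡ false

Meets : ∀ {n} → Subset n → Subset n → Set
Meets I S = ∃ λ v → v ∈ S × v ∈ I

-- n! * (Σ_{i=0}^{m} a^i / i!) = Σ_{i=0}^{m} a^i * (m!/i!), using m!/i! = m P (m ∸ i)
scaledExpPartialSum : ℕ → ℕ → ℕ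
scaledExpPartialSum a m = sum (map (λ i → a ^ i * (m P (m ∸ i))) (upTo (suc m)))

-- N ≤ e^(a/b)  (for b ≥ 1), encoded exactly in ℕ:
-- N ≤ e^(a/b)  ⇔  N^b ≤ e^a  ⇔  ∃ m. N^b ≤ Σ_{i≤m} a^i / i!
-- (for a = 0 all partial sums equal 1 = e^0; for a ≥ 1, e^a is irrational
--  and the partial sums increase strictly to e^a).
≤Exp : ℕ → ℕ → ℕ → Set
≤Exp N a b = ∃ λ m → N ^ b * (m !) ≤ scaledExpPartialSum a m

-- Write p = 2d and q = 2d + 1.  The independent set is built greedily: pick a candidate
-- vertex v, delete its closed neighbourhood N[v] from the candidate set U and discard the
-- sets containing v.  The choice of v is derandomised with the potential
-- Σ_{S ∈ F} (p/q)^{|S ∩ U|}.  For S ∌ v, deleting N[v] multiplies the term of S by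
-- (q/p)^j ≤ 1 + j/d, where j = |N(v) ∩ S ∩ U| ≤ d; since Σ_v j ≤ d |S ∩ U| by double
-- counting, the average over v ∈ U of the new term is at most the old one, so some v does
-- not increase the potential.  A set disjoint from U contributes 1 on its own, so while the
-- potential stays below 1 every remaining set meets U, and the process ends with all sets
-- hit.  Initially the potential is at most |F| (p/q)^k, and |F| < (q/p)^k follows from
-- 6|F| ≤ e^{k/(6d)} because (1 + 1/(2d))^{2d} ≥ 2 and e^k ≤ (2k + 1) 4^k.

{-# OPTIONS --safe #-}
module Submission where

open import Defs hiding (sym)
open import Data.Nat using (ℕ; zero; suc; _+_; _*_; _∸_; _^_; _≤_; _<_; _≤′_; ≤′-refl; ≤′-step; _!; z≤n; s≤s;
  NonZero; >-nonZero; >-nonZero⁻¹)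
open import Data.Nat.Properties hiding (_≟_)
open import Data.Nat.Combinatorics using (_P_; nPk≡n!/[n∸k]!)
open import Data.Nat.DivMod using (_/_; m/n*n≡m; /-congʳ)
open import Data.Nat.Divisibility using (m≤n⇒m!∣n!)
open import Data.Nat.ListAction using (sum)
open import Data.Nat.ListAction.Properties using (sum-++)
open import Data.Nat.Solver using (module +-*-Solver)
open import Data.Bool using (Bool; true; false; _∧_; not; T; T?)
open import Data.Bool.Properties using (∧-assoc; ∧-identityʳ; ∧-zeroʳ) renaming (_≟_ to _≟ᵇ_)
open import Data.Fin using (Fin; zero; suc; _≟_)
open import Data.Fin.Properties using (any?)
open import Data.Fin.Subset using (Subset; _∈_; ⊥; ⁅_⁆; _∪_; ∣_∣)
open import Data.Fin.Subset.Properties using (∉⊥; x∈⁅x⁆; x∈⁅y⁆⇒x≡y; x∈p∪q⁻; x∈p∪q⁺)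
open import Data.Vec using ([]; _∷_; lookup; tabulate)
open import Data.Vec.Properties using (lookup∘tabulate; lookup⇒[]=)
open import Data.List using (List; []; _∷_; map; filterᵇ; length; upTo; _++_; [_])
open import Data.List.Properties using (map-cong; upTo-∷ʳ; map-++; map-cong-local)
open import Data.List.Membership.Propositional using () renaming (_∈_ to _∈ₗ_)
open import Data.List.Membership.Propositional.Properties using (∈-filter⁺; ∈-upTo⁻)
open import Data.List.Relation.Unary.Any using (here; there)
import Data.List.Relation.Unary.All as All
open import Data.List.Relation.Unary.Unique.Propositional using (Unique)
open import Algebra.Properties.Semiring.Sum +-*-semiring
  using (sum-syntax; sum-cong-≗; sum-replicate-zero; ∑-distrib-+; ∑-comm; *-distribˡ-sum; *-distribʳ-sum)
  renaming (sum to ∑)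
open import Data.Product using (∃; _×_; _,_; proj₁; proj₂)
open import Data.Sum using (_⊎_; inj₁; inj₂; map₂)
open import Function using (_∘_)
open import Relation.Binary.PropositionalEquality using (_≡_; refl; sym; trans; cong; cong₂; subst; subst₂)
open import Relation.Nullary using (yes; no; does)
open import Relation.Nullary.Decidable using (_×-dec_; dec-true)
open import Relation.Nullary.Negation using (contradiction)

open +-*-Solver
open ≤-Reasoning

χ : Bool → ℕ
χ true = 1
χ false = 0

χ-∧ : ∀ a b → χ (a ∧ b) ≡ χ a * χ b
χ-∧ true b = sym (+-identityʳ (χ b))
χ-∧ false b = refl

χ+χ-not : ∀ b → χ b + χ (not b) ≡ 1
χ+χ-not true = refl
χ+χ-not false = refl

χ-∧-≤ˡ : ∀ a b → χ (a ∧ b) ≤ χ a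
χ-∧-≤ˡ true true = ≤-refl
χ-∧-≤ˡ true false = z≤n
χ-∧-≤ˡ false b = z≤n

∑-mono-≤ : ∀ {n} {f g : Fin n → ℕ} → (∀ i → f i ≤ g i) → ∑[ i < n ] f i ≤ ∑[ i < n ] g i
∑-mono-≤ {zero} f≤g = z≤n
∑-mono-≤ {suc n} f≤g = +-mono-≤ (f≤g zero) (∑-mono-≤ (λ i → f≤g (suc i)))

∑-mono-< : ∀ {n} {f g : Fin n → ℕ} → (∀ i → f i ≤ g i) → ∀ j → f j < g j → ∑[ i < n ] f i < ∑[ i < n ] g i
∑-mono-< f≤g zero fj<gj = +-mono-<-≤ fj<gj (∑-mono-≤ (λ i → f≤g (suc i)))
∑-mono-< f≤g (suc j) fj<gj = +-mono-≤-< (f≤g zero) (∑-mono-< (λ i → f≤g (suc i)) j fj<gj)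

∑-const : ∀ n c → ∑[ i < n ] c ≡ n * c
∑-const zero c = refl
∑-const (suc n) c = cong (c +_) (∑-const n c)

size : ∀ {n} → (Fin n → Bool) → ℕ
size {n} X = ∑[ i < n ] χ (X i)

size+size-not : ∀ {n} (X : Fin n → Bool) → size X + size (λ i → not (X i)) ≡ n
size+size-not {n} X = begin-equality
  size X + size (λ i → not (X i))        ≡⟨ ∑-distrib-+ (λ i → χ (X i)) (λ i → χ (not (X i))) ⟨
  ∑[ i < n ] (χ (X i) + χ (not (X i)))   ≡⟨ sum-cong-≗ (λ i → χ+χ-not (X i)) ⟩
  ∑[ i < n ] 1                           ≡⟨ ∑-const n 1 ⟩
  n * 1                                  ≡⟨ *-identityʳ n ⟩
  n                                      ∎

size-∧-≤ˡ : ∀ {n} (X Y : Fin n → Bool) → size (λ i → X i ∧ Y i) ≤ size X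
size-∧-≤ˡ X Y = ∑-mono-≤ (λ i → χ-∧-≤ˡ (X i) (Y i))

size-∧-≤ʳ : ∀ {n} (X Y : Fin n → Bool) → size (λ i → X i ∧ Y i) ≤ size Y
size-∧-≤ʳ X Y = ∑-mono-≤ (λ i → χ-∧-≤ʳ (X i) (Y i))
  where
  χ-∧-≤ʳ : ∀ a b → χ (a ∧ b) ≤ χ b
  χ-∧-≤ʳ true b = ≤-refl
  χ-∧-≤ʳ false b = z≤n

size-∧-<ˡ : ∀ {n} (X Y : Fin n → Bool) {j} → X j ≡ true → Y j ≡ false → size (λ i → X i ∧ Y i) < size X
size-∧-<ˡ X Y {j} Xj Yj = ∑-mono-< (λ i → χ-∧-≤ˡ (X i) (Y i)) j (subst₂ (λ a b → χ (a ∧ b) < χ a) (sym Xj) (sym Yj) ≤-refl)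

size-not∧+size-∧ : ∀ {n} (X Y : Fin n → Bool) → size (λ i → not (Y i) ∧ X i) + size (λ i → Y i ∧ X i) ≡ size X
size-not∧+size-∧ X Y = trans (sym (∑-distrib-+ (λ i → χ (not (Y i) ∧ X i)) (λ i → χ (Y i ∧ X i)))) (sum-cong-≗ (λ i → split (X i) (Y i)))
  where
  split : ∀ a b → χ (not b ∧ a) + χ (b ∧ a) ≡ χ a
  split a true = refl
  split a false = +-identityʳ (χ a)

∣p∣≡size : ∀ {n} (p : Subset n) → ∣ p ∣ ≡ size (lookup p)
∣p∣≡size [] = refl
∣p∣≡size (true ∷ p) = cong suc (∣p∣≡size p)
∣p∣≡size (false ∷ p) = ∣p∣≡size p

∃-below-average : ∀ {n} (U : Fin n → Bool) (f : Fin n → ℕ) c → 0 < size U →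
  ∑[ v < n ] (χ (U v) * f v) ≤ size U * c → ∃ λ v → U v ≡ true × f v ≤ c
∃-below-average {n} U f c 0<size avg with any? (λ v → (U v ≟ᵇ true) ×-dec (f v ≤? c))
... | yes witness = witness
... | no ∄ = contradiction avg (<⇒≱ (begin-strict
  size U * c                    <⟨ *-monoʳ-< (size U) {{>-nonZero 0<size}} (n<1+n c) ⟩
  size U * suc c                ≡⟨ *-distribʳ-sum (suc c) (λ v → χ (U v)) ⟩
  ∑[ v < n ] (χ (U v) * suc c)  ≤⟨ ∑-mono-≤ above ⟩
  ∑[ v < n ] (χ (U v) * f v)    ∎))
  where
  above : ∀ v → χ (U v) * suc c ≤ χ (U v) * f v
  above v with U v in Uv
  ... | false = z≤n
  ... | true  = *-monoʳ-≤ 1 (≰⇒> (λ fv≤c → ∄ (v , Uv , fv≤c)))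

sum-map-mono-≤ : ∀ {a} {A : Set a} {f g : A → ℕ} xs → (∀ {x} → x ∈ₗ xs → f x ≤ g x) →
  sum (map f xs) ≤ sum (map g xs)
sum-map-mono-≤ [] f≤g = z≤n
sum-map-mono-≤ (x ∷ xs) f≤g = +-mono-≤ (f≤g (here refl)) (sum-map-mono-≤ xs (λ x∈xs → f≤g (there x∈xs)))

sum-map-const : ∀ {a} {A : Set a} (xs : List A) c → sum (map (λ _ → c) xs) ≡ length xs * c
sum-map-const [] c = refl
sum-map-const (x ∷ xs) c = cong (c +_) (sum-map-const xs c)

sum-map-*ˡ : ∀ {a} {A : Set a} c (f : A → ℕ) xs → sum (map (λ x → c * f x) xs) ≡ c * sum (map f xs)
sum-map-*ˡ c f [] = sym (*-zeroʳ c)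
sum-map-*ˡ c f (x ∷ xs) = trans (cong (c * f x +_) (sum-map-*ˡ c f xs)) (sym (*-distribˡ-+ c (f x) _))

sum-map-filterᵇ : ∀ {a} {A : Set a} (keep : A → Bool) (f : A → ℕ) xs →
  sum (map f (filterᵇ keep xs)) ≡ sum (map (λ x → χ (keep x) * f x) xs)
sum-map-filterᵇ keep f [] = refl
sum-map-filterᵇ keep f (x ∷ xs) with keep x
... | true  = cong₂ _+_ (sym (+-identityʳ (f x))) (sum-map-filterᵇ keep f xs)
... | false = sum-map-filterᵇ keep f xs

∑-sum-map-comm : ∀ {a} {A : Set a} {n} (f : Fin n → A → ℕ) xs →
  ∑[ i < n ] sum (map (f i) xs) ≡ sum (map (λ x → ∑[ i < n ] f i x) xs)
∑-sum-map-comm {n = n} f [] = sum-replicate-zero n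
∑-sum-map-comm f (x ∷ xs) = trans (∑-distrib-+ (λ i → f i x) (λ i → sum (map (f i) xs)))
  (cong (∑ (λ i → f i x) +_) (∑-sum-map-comm f xs))

-- Partial sums of the exponential series

n^i*n!≤[i+n]! : ∀ n i → n ^ i * n ! ≤ (i + n) !
n^i*n!≤[i+n]! n zero = ≤-reflexive (*-identityˡ (n !))
n^i*n!≤[i+n]! n (suc i) = begin
  n * n ^ i * n !        ≡⟨ *-assoc n (n ^ i) (n !) ⟩
  n * (n ^ i * n !)      ≤⟨ *-mono-≤ (m≤n+m n (suc i)) (n^i*n!≤[i+n]! n i) ⟩
  suc (i + n) * (i + n) ! ∎

[n+n]!≤4^n*n!*n! : ∀ n → (n + n) ! ≤ 4 ^ n * (n ! * n !)
[n+n]!≤4^n*n!*n! zero = ≤-refl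
[n+n]!≤4^n*n!*n! (suc n) = begin
  (suc n + suc n) !                              ≡⟨ cong (λ m → suc m !) (+-suc n n) ⟩
  (2 + (n + n)) * ((1 + (n + n)) * (n + n) !)    ≡⟨ *-assoc (2 + (n + n)) (1 + (n + n)) ((n + n) !) ⟨
  (2 + (n + n)) * (1 + (n + n)) * (n + n) !      ≤⟨ *-mono-≤ two-steps ([n+n]!≤4^n*n!*n! n) ⟩
  4 * (suc n * suc n) * (4 ^ n * (n ! * n !))    ≡⟨ solve 4 (λ a b c d → con 4 :* (a :* a) :* (b :* (c :* c))
                                                                   := con 4 :* b :* ((a :* c) :* (a :* c))) refl (suc n) (4 ^ n) (n !) (n !) ⟩
  4 * 4 ^ n * (suc n ! * suc n !)                ∎
  where
  two-steps : (2 + (n + n)) * (1 + (n + n)) ≤ 4 * (suc n * suc n)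
  two-steps = begin
    (2 + (n + n)) * (1 + (n + n)) ≤⟨ *-monoʳ-≤ (2 + (n + n)) (n≤1+n (1 + (n + n))) ⟩
    (2 + (n + n)) * (2 + (n + n)) ≡⟨ solve 1 (λ a → (con 2 :+ (a :+ a)) :* (con 2 :+ (a :+ a)) := con 4 :* ((con 1 :+ a) :* (con 1 :+ a))) refl n ⟩
    4 * (suc n * suc n)           ∎

n^n≤4^n*n! : ∀ n → n ^ n ≤ 4 ^ n * n !
n^n≤4^n*n! n = *-cancelʳ-≤ (n ^ n) (4 ^ n * n !) (n !) {{n !≢0}} (begin
  n ^ n * n !           ≤⟨ n^i*n!≤[i+n]! n n ⟩
  (n + n) !             ≤⟨ [n+n]!≤4^n*n!*n! n ⟩
  4 ^ n * (n ! * n !)   ≡⟨ *-assoc (4 ^ n) (n !) (n !) ⟨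
  4 ^ n * n ! * n !     ∎)

nP[n∸i]*i!≡n! : ∀ {n i} → i ≤ n → (n P (n ∸ i)) * i ! ≡ n !
nP[n∸i]*i!≡n! {n} {i} i≤n = begin-equality
  (n P (n ∸ i)) * i !          ≡⟨ cong (_* i !) (nPk≡n!/[n∸k]! (m∸n≤m n i)) ⟩
  n ! / (n ∸ (n ∸ i)) ! * i !  ≡⟨ cong (_* i !) (/-congʳ (cong _! (m∸[m∸n]≡n i≤n))) ⟩
  n ! / i ! * i !              ≡⟨ m/n*n≡m (m≤n⇒m!∣n! i≤n) ⟩
  n !                          ∎
  where instance
  _ = i !≢0
  _ = (n ∸ (n ∸ i)) !≢0

[1+n]P[1+n∸i]≡[1+n]*nP[n∸i] : ∀ {n i} → i ≤ n → suc n P (suc n ∸ i) ≡ suc n * (n P (n ∸ i))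
[1+n]P[1+n∸i]≡[1+n]*nP[n∸i] {n} {i} i≤n = *-cancelʳ-≡ _ _ (i !) {{i !≢0}} (begin-equality
  (suc n P (suc n ∸ i)) * i !    ≡⟨ nP[n∸i]*i!≡n! (m≤n⇒m≤1+n i≤n) ⟩
  suc n * n !                    ≡⟨ cong (suc n *_) (nP[n∸i]*i!≡n! i≤n) ⟨
  suc n * ((n P (n ∸ i)) * i !)  ≡⟨ *-assoc (suc n) (n P (n ∸ i)) (i !) ⟨
  suc n * (n P (n ∸ i)) * i !    ∎)

scaledExpPartialSum-suc : ∀ a m → scaledExpPartialSum a (suc m) ≡ suc m * scaledExpPartialSum a m + a ^ suc m
scaledExpPartialSum-suc a m = begin-equality
  sum (map (term (suc m)) (upTo (suc (suc m))))
    ≡⟨ cong (sum ∘ map (term (suc m))) (upTo-∷ʳ (suc m)) ⟨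
  sum (map (term (suc m)) (upTo (suc m) ++ [ suc m ]))
    ≡⟨ cong sum (map-++ (term (suc m)) (upTo (suc m)) [ suc m ]) ⟩
  sum (map (term (suc m)) (upTo (suc m)) ++ [ term (suc m) (suc m) ])
    ≡⟨ sum-++ (map (term (suc m)) (upTo (suc m))) [ term (suc m) (suc m) ] ⟩
  sum (map (term (suc m)) (upTo (suc m))) + (term (suc m) (suc m) + 0)
    ≡⟨ cong₂ _+_ (cong sum (map-cong-local (All.tabulate (earlier-term ∘ ∈-upTo⁻)))) last-term ⟩
  sum (map (λ i → suc m * term m i) (upTo (suc m))) + a ^ suc m
    ≡⟨ cong (_+ a ^ suc m) (sum-map-*ˡ (suc m) (term m) (upTo (suc m))) ⟩
  suc m * sum (map (term m) (upTo (suc m))) + a ^ suc m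
    ∎
  where
  term : ℕ → ℕ → ℕ
  term m i = a ^ i * (m P (m ∸ i))
  earlier-term : ∀ {i} → i < suc m → term (suc m) i ≡ suc m * term m i
  earlier-term {i} (s≤s i≤m) = begin-equality
    a ^ i * (suc m P (suc m ∸ i))      ≡⟨ cong (a ^ i *_) ([1+n]P[1+n∸i]≡[1+n]*nP[n∸i] i≤m) ⟩
    a ^ i * (suc m * (m P (m ∸ i)))    ≡⟨ solve 3 (λ x y z → x :* (y :* z) := y :* (x :* z)) refl (a ^ i) (suc m) (m P (m ∸ i)) ⟩
    suc m * (a ^ i * (m P (m ∸ i)))    ∎
  last-term : term (suc m) (suc m) + 0 ≡ a ^ suc m
  last-term = begin-equality
    a ^ suc m * (suc m P (m ∸ m)) + 0 ≡⟨ +-identityʳ _ ⟩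
    a ^ suc m * (suc m P (m ∸ m))     ≡⟨ cong (λ j → a ^ suc m * (suc m P j)) (n∸n≡0 m) ⟩
    a ^ suc m * 1                     ≡⟨ *-identityʳ (a ^ suc m) ⟩
    a ^ suc m                         ∎

module _ (a : ℕ) where

  scaledExpPartialSum≤[1+m]*a^m : ∀ {m} → m ≤ a → scaledExpPartialSum a m ≤ suc m * a ^ m
  scaledExpPartialSum≤[1+m]*a^m {zero} _ = ≤-refl
  scaledExpPartialSum≤[1+m]*a^m {suc m} 1+m≤a = begin
    scaledExpPartialSum a (suc m)              ≡⟨ scaledExpPartialSum-suc a m ⟩
    suc m * scaledExpPartialSum a m + a ^ suc m
      ≤⟨ +-monoˡ-≤ (a ^ suc m) (*-monoʳ-≤ (suc m) (scaledExpPartialSum≤[1+m]*a^m (<⇒≤ 1+m≤a))) ⟩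
    suc m * (suc m * a ^ m) + a ^ suc m        ≤⟨ +-monoˡ-≤ (a ^ suc m) (*-monoʳ-≤ (suc m) (*-monoˡ-≤ (a ^ m) 1+m≤a)) ⟩
    suc m * (a * a ^ m) + a * a ^ m            ≡⟨ +-comm (suc m * (a * a ^ m)) (a * a ^ m) ⟩
    suc (suc m) * a ^ suc m                    ∎

  -- With e_m = Σ_{i ≤ m} a^i / i!, this says e_m + a · a^m / m! ≤ (2a + 1) 4^a: once m ≥ a
  -- the second summand bounds the tail of the series, so the invariant survives each step.
  scaledExpPartialSum+a^[1+m]≤ : ∀ {m} → a ≤′ m → scaledExpPartialSum a m + a ^ suc m ≤ suc (a + a) * 4 ^ a * m !
  scaledExpPartialSum+a^[1+m]≤ ≤′-refl = begin
    scaledExpPartialSum a a + a * a ^ a   ≤⟨ +-monoˡ-≤ (a * a ^ a) (scaledExpPartialSum≤[1+m]*a^m ≤-refl) ⟩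
    suc a * a ^ a + a * a ^ a             ≡⟨ *-distribʳ-+ (a ^ a) (suc a) a ⟨
    suc (a + a) * a ^ a                   ≤⟨ *-monoʳ-≤ (suc (a + a)) (n^n≤4^n*n! a) ⟩
    suc (a + a) * (4 ^ a * a !)           ≡⟨ *-assoc (suc (a + a)) (4 ^ a) (a !) ⟨
    suc (a + a) * 4 ^ a * a !             ∎
  scaledExpPartialSum+a^[1+m]≤ {suc m} (≤′-step a≤′m) = begin
    scaledExpPartialSum a (suc m) + a ^ suc (suc m)
      ≡⟨ cong (_+ a ^ suc (suc m)) (scaledExpPartialSum-suc a m) ⟩
    suc m * scaledExpPartialSum a m + a ^ suc m + a * a ^ suc m
      ≡⟨ +-assoc (suc m * scaledExpPartialSum a m) (a ^ suc m) (a * a ^ suc m) ⟩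
    suc m * scaledExpPartialSum a m + suc a * a ^ suc m
      ≤⟨ +-monoʳ-≤ (suc m * scaledExpPartialSum a m) (*-monoˡ-≤ (a ^ suc m) (s≤s (≤′⇒≤ a≤′m))) ⟩
    suc m * scaledExpPartialSum a m + suc m * a ^ suc m
      ≡⟨ *-distribˡ-+ (suc m) (scaledExpPartialSum a m) (a ^ suc m) ⟨
    suc m * (scaledExpPartialSum a m + a ^ suc m)
      ≤⟨ *-monoʳ-≤ (suc m) (scaledExpPartialSum+a^[1+m]≤ a≤′m) ⟩
    suc m * (suc (a + a) * 4 ^ a * m !)
      ≡⟨ solve 3 (λ x y z → x :* (y :* z) := y :* (x :* z)) refl (suc m) (suc (a + a) * 4 ^ a) (m !) ⟩
    suc (a + a) * 4 ^ a * suc m !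
      ∎

  *!≤scaledExpPartialSum-mono : ∀ {N m m′} → m ≤′ m′ →
    N * m ! ≤ scaledExpPartialSum a m → N * m′ ! ≤ scaledExpPartialSum a m′
  *!≤scaledExpPartialSum-mono ≤′-refl h = h
  *!≤scaledExpPartialSum-mono {N} {m′ = suc m′} (≤′-step m≤′m′) h = begin
    N * (suc m′ * m′ !)                             ≡⟨ solve 3 (λ x y z → x :* (y :* z) := y :* (x :* z)) refl N (suc m′) (m′ !) ⟩
    suc m′ * (N * m′ !)                             ≤⟨ *-monoʳ-≤ (suc m′) (*!≤scaledExpPartialSum-mono {N} m≤′m′ h) ⟩
    suc m′ * scaledExpPartialSum a m′               ≤⟨ m≤m+n _ (a ^ suc m′) ⟩
    suc m′ * scaledExpPartialSum a m′ + a ^ suc m′  ≡⟨ scaledExpPartialSum-suc a m′ ⟨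
    scaledExpPartialSum a (suc m′)                  ∎

≤Exp⇒^≤ : ∀ {N a b} → ≤Exp N a b → N ^ b ≤ suc (a + a) * 4 ^ a
≤Exp⇒^≤ {N} {a} {b} (m , h) = *-cancelʳ-≤ (N ^ b) (suc (a + a) * 4 ^ a) (m′ !) {{m′ !≢0}} (begin
  N ^ b * m′ !                                 ≤⟨ *!≤scaledExpPartialSum-mono a {N ^ b} (≤⇒≤′ (m≤m+n m a)) h ⟩
  scaledExpPartialSum a m′                     ≤⟨ m≤m+n _ (a ^ suc m′) ⟩
  scaledExpPartialSum a m′ + a ^ suc m′        ≤⟨ scaledExpPartialSum+a^[1+m]≤ a (≤⇒≤′ (m≤n+m a m)) ⟩
  suc (a + a) * 4 ^ a * m′ !                   ∎)
  where
  m′ = m + a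

-- Powers of 1 + 1/(2d)

^-distribʳ-* : ∀ m n o → (m * n) ^ o ≡ m ^ o * n ^ o
^-distribʳ-* m n zero = refl
^-distribʳ-* m n (suc o) = trans (cong (m * n *_) (^-distribʳ-* m n o))
  (solve 4 (λ a b c d → a :* b :* (c :* d) := a :* c :* (b :* d)) refl m n (m ^ o) (n ^ o))

n<2^n : ∀ n → n < 2 ^ n
n<2^n zero = s≤s z≤n
n<2^n (suc n) = +-mono-≤ (m^n>0 2 n) (≤-trans (n<2^n n) (m≤m+n (2 ^ n) 0))

bernoulli : ∀ a n → a ^ n * (a + n) ≤ a * suc a ^ n
bernoulli a zero = ≤-reflexive (trans (*-identityˡ (a + 0)) (trans (+-identityʳ a) (sym (*-identityʳ a))))
bernoulli a (suc n) = begin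
  a * a ^ n * (a + suc n)         ≡⟨ solve 3 (λ a x n → a :* x :* (a :+ (con 1 :+ n)) := x :* (a :* (a :+ n) :+ a)) refl a (a ^ n) n ⟩
  a ^ n * (a * (a + n) + a)       ≤⟨ *-monoʳ-≤ (a ^ n) (+-monoʳ-≤ (a * (a + n)) (m≤m+n a n)) ⟩
  a ^ n * (a * (a + n) + (a + n)) ≡⟨ solve 3 (λ a x n → x :* (a :* (a :+ n) :+ (a :+ n)) := (con 1 :+ a) :* (x :* (a :+ n))) refl a (a ^ n) n ⟩
  suc a * (a ^ n * (a + n))       ≤⟨ *-monoʳ-≤ (suc a) (bernoulli a n) ⟩
  suc a * (a * suc a ^ n)         ≡⟨ solve 3 (λ x y z → x :* (y :* z) := y :* (x :* z)) refl (suc a) a (suc a ^ n) ⟩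
  a * (suc a * suc a ^ n)         ∎

2*a^a≤[1+a]^a : ∀ a .{{_ : NonZero a}} → 2 * a ^ a ≤ suc a ^ a
2*a^a≤[1+a]^a a = *-cancelˡ-≤ a (begin
  a * (2 * a ^ a)  ≡⟨ solve 2 (λ a x → a :* (con 2 :* x) := x :* (a :+ a)) refl a (a ^ a) ⟩
  a ^ a * (a + a)  ≤⟨ bernoulli a a ⟩
  a * suc a ^ a    ∎)

2^k≤m^p : ∀ {m p k} .{{_ : NonZero p}} → suc p ^ k ≤ m * p ^ k → 2 ^ k ≤ m ^ p
2^k≤m^p {m} {p} {k} q^k≤m*p^k = *-cancelʳ-≤ (2 ^ k) (m ^ p) ((p ^ k) ^ p) {{m^n≢0 (p ^ k) p {{m^n≢0 p k}}}} (begin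
  2 ^ k * (p ^ k) ^ p     ≡⟨ cong (2 ^ k *_) (^-*-comm p k p) ⟩
  2 ^ k * (p ^ p) ^ k     ≡⟨ ^-distribʳ-* 2 (p ^ p) k ⟨
  (2 * p ^ p) ^ k         ≤⟨ ^-monoˡ-≤ k (2*a^a≤[1+a]^a p) ⟩
  (suc p ^ p) ^ k         ≡⟨ ^-*-comm (suc p) p k ⟩
  (suc p ^ k) ^ p         ≤⟨ ^-monoˡ-≤ p q^k≤m*p^k ⟩
  (m * p ^ k) ^ p         ≡⟨ ^-distribʳ-* m (p ^ k) p ⟩
  m ^ p * (p ^ k) ^ p     ∎)
  where
  ^-*-comm : ∀ x i j → (x ^ i) ^ j ≡ (x ^ j) ^ i
  ^-*-comm x i j = trans (^-*-assoc x i j) (trans (cong (x ^_) (*-comm i j)) (sym (^-*-assoc x j i)))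

≤Exp⇒*^<^ : ∀ m k d .{{_ : NonZero d}} → ≤Exp (6 * m) k (6 * d) → m * (d + d) ^ k < suc (d + d) ^ k
≤Exp⇒*^<^ m k d small = ≰⇒> λ q^k≤m*p^k → <⇒≱ (begin-strict
  suc (k + k) * 4 ^ k                <⟨ *-monoˡ-< (4 ^ k) {{m^n≢0 4 k}} 1+k+k<2^k+2^k ⟩
  (2 ^ k + 2 ^ k) * 4 ^ k            ≡⟨ cong ((2 ^ k + 2 ^ k) *_) (^-distribʳ-* 2 2 k) ⟩
  (2 ^ k + 2 ^ k) * (2 ^ k * 2 ^ k)  ≡⟨ solve 1 (λ x → (x :+ x) :* (x :* x) := con 2 :* (x :^ 3)) refl (2 ^ k) ⟩
  2 * (2 ^ k) ^ 3                    ≤⟨ *-mono-≤ 2≤6^6d (^-monoˡ-≤ 3 (2^k≤m^p {m} {d + d} {k} {{d+d≢0}} q^k≤m*p^k)) ⟩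
  6 ^ (6 * d) * (m ^ (d + d)) ^ 3    ≡⟨ cong (6 ^ (6 * d) *_) (^-*-assoc m (d + d) 3) ⟩
  6 ^ (6 * d) * m ^ ((d + d) * 3)    ≡⟨ cong (λ e → 6 ^ (6 * d) * m ^ e) (solve 1 (λ d → (d :+ d) :* con 3 := con 6 :* d) refl d) ⟩
  6 ^ (6 * d) * m ^ (6 * d)          ≡⟨ ^-distribʳ-* 6 m (6 * d) ⟨
  (6 * m) ^ (6 * d)                  ∎) (≤Exp⇒^≤ {6 * m} {k} {6 * d} small)
  where
  d+d≢0 : NonZero (d + d)
  d+d≢0 = >-nonZero (≤-trans (>-nonZero⁻¹ d) (m≤m+n d d))
  1+k+k<2^k+2^k : suc (k + k) < 2 ^ k + 2 ^ k
  1+k+k<2^k+2^k = ≤-trans (s≤s (≤-reflexive (sym (+-suc k k)))) (+-mono-≤ (n<2^n k) (n<2^n k))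
  2≤6^6d : 2 ≤ 6 ^ (6 * d)
  2≤6^6d = ≤-trans (s≤s (s≤s z≤n)) (^-monoʳ-≤ 6 {1} {6 * d} (≤-trans (>-nonZero⁻¹ d) (m≤n*m d 6)))

a^h*b^k≤a^k*b^h : ∀ {a b h k} → a ≤ b → k ≤ h → a ^ h * b ^ k ≤ a ^ k * b ^ h
a^h*b^k≤a^k*b^h {a} {b} {h} {k} a≤b k≤h = begin
  a ^ h * b ^ k              ≡⟨ cong (λ e → a ^ e * b ^ k) h≡k+r ⟩
  a ^ (k + r) * b ^ k        ≡⟨ cong (_* b ^ k) (^-distribˡ-+-* a k r) ⟩
  a ^ k * a ^ r * b ^ k      ≤⟨ *-monoˡ-≤ (b ^ k) (*-monoʳ-≤ (a ^ k) (^-monoˡ-≤ r a≤b)) ⟩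
  a ^ k * b ^ r * b ^ k      ≡⟨ *-assoc (a ^ k) (b ^ r) (b ^ k) ⟩
  a ^ k * (b ^ r * b ^ k)    ≡⟨ cong (a ^ k *_) (^-distribˡ-+-* b r k) ⟨
  a ^ k * b ^ (r + k)        ≡⟨ cong (λ e → a ^ k * b ^ e) (trans (+-comm r k) (sym h≡k+r)) ⟩
  a ^ k * b ^ h              ∎
  where
  r = h ∸ k
  h≡k+r : h ≡ k + r
  h≡k+r = sym (m+[n∸m]≡n k≤h)

[1+2d]^j*d≤[2d]^j*[d+j] : ∀ {d j} → j ≤ d → suc (d + d) ^ j * d ≤ (d + d) ^ j * (d + j)
[1+2d]^j*d≤[2d]^j*[d+j] {d} {zero} _ = ≤-reflexive (trans (+-identityʳ d) (sym (trans (+-identityʳ (d + 0)) (+-identityʳ d))))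
[1+2d]^j*d≤[2d]^j*[d+j] {d} {suc j} 1+j≤d = begin
  q * q ^ j * d               ≡⟨ *-assoc q (q ^ j) d ⟩
  q * (q ^ j * d)             ≤⟨ *-monoʳ-≤ q ([1+2d]^j*d≤[2d]^j*[d+j] (<⇒≤ 1+j≤d)) ⟩
  q * (p ^ j * (d + j))       ≡⟨ solve 3 (λ q x y → q :* (x :* y) := x :* (q :* y)) refl q (p ^ j) (d + j) ⟩
  p ^ j * (q * (d + j))       ≤⟨ *-monoʳ-≤ (p ^ j) q*[d+j]≤p*[d+1+j] ⟩
  p ^ j * (p * (d + suc j))   ≡⟨ solve 3 (λ x p y → x :* (p :* y) := p :* x :* y) refl (p ^ j) p (d + suc j) ⟩
  p * p ^ j * (d + suc j)     ∎
  where
  p = d + d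
  q = suc p
  q*[d+j]≤p*[d+1+j] : q * (d + j) ≤ p * (d + suc j)
  q*[d+j]≤p*[d+1+j] = begin
    q * (d + j)               ≡⟨ solve 2 (λ d j → (con 1 :+ (d :+ d)) :* (d :+ j) := (d :+ d) :* (d :+ j) :+ (d :+ j)) refl d j ⟩
    p * (d + j) + (d + j)     ≤⟨ +-monoʳ-≤ (p * (d + j)) (+-monoʳ-≤ d (<⇒≤ 1+j≤d)) ⟩
    p * (d + j) + (d + d)     ≡⟨ solve 2 (λ d j → (d :+ d) :* (d :+ j) :+ (d :+ d) := (d :+ d) :* (d :+ (con 1 :+ j))) refl d j ⟩
    p * (d + suc j)           ∎

module _ {n} (G : Graph n) where

  degree≡size : ∀ v → degree G v ≡ size (adj G v)
  degree≡size v = trans (∣p∣≡size (tabulate (adj G v))) (sum-cong-≗ (cong χ ∘ lookup∘tabulate (adj G v)))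

  ∑-size-adj∧≤ : ∀ {d} → MaxDegree≤ G d → ∀ X → ∑[ v < n ] size (λ u → adj G v u ∧ X u) ≤ d * size X
  ∑-size-adj∧≤ {d} maxdeg X = begin
    ∑[ v < n ] ∑[ u < n ] χ (adj G v u ∧ X u)  ≡⟨ ∑-comm (λ v u → χ (adj G v u ∧ X u)) ⟩
    ∑[ u < n ] ∑[ v < n ] χ (adj G v u ∧ X u)  ≡⟨ sum-cong-≗ count-by-u ⟩
    ∑[ u < n ] (size (adj G u) * χ (X u))      ≤⟨ ∑-mono-≤ (λ u → *-monoˡ-≤ (χ (X u)) (subst (_≤ d) (degree≡size u) (maxdeg u))) ⟩
    ∑[ u < n ] (d * χ (X u))                   ≡⟨ *-distribˡ-sum d (χ ∘ X) ⟨
    d * size X                                 ∎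
    where
    count-by-u : ∀ u → ∑[ v < n ] χ (adj G v u ∧ X u) ≡ size (adj G u) * χ (X u)
    count-by-u u = trans (sum-cong-≗ (λ v → trans (χ-∧ (adj G v u) (X u)) (cong (λ b → χ b * χ (X u)) (Graph.sym G v u))))
                         (sym (*-distribʳ-sum (χ (X u)) (χ ∘ adj G u)))

-- The greedy transversal

module Greedy {n} (G : Graph n) (d : ℕ) {{_ : NonZero d}} (maxdeg : MaxDegree≤ G d) where

  p q : ℕ
  p = d + d
  q = suc p

  _∩_ : Subset n → (Fin n → Bool) → Fin n → Bool
  (S ∩ U) u = lookup S u ∧ U u

  hits misses : Subset n → (Fin n → Bool) → ℕ
  hits S U = size (S ∩ U)
  misses S U = size (not ∘ (S ∩ U))

  -- q ^ n · (p / q) ^ |S ∩ U|, as hits S U + misses S U = n.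
  weight : Subset n → (Fin n → Bool) → ℕ
  weight S U = p ^ hits S U * q ^ misses S U

  potential : (Fin n → Bool) → List (Subset n) → ℕ
  potential U F = sum (map (λ S → weight S U) F)

  infixl 5 _∖N[_]
  _∖N[_] : (Fin n → Bool) → Fin n → Fin n → Bool
  (U ∖N[ v ]) u = U u ∧ not (adj G v u) ∧ not (does (v ≟ u))

  everything : Fin n → Bool
  everything _ = true

  survivors : Fin n → List (Subset n) → List (Subset n)
  survivors v = filterᵇ (λ S → not (lookup S v))

  adjHits : Fin n → Subset n → (Fin n → Bool) → ℕ
  adjHits v S U = size (λ u → adj G v u ∧ (S ∩ U) u)

  ∖N⁻ : ∀ U v {u} → (U ∖N[ v ]) u ≡ true → U u ≡ true × adj G v u ≡ false
  ∖N⁻ U v {u} _ with U u | adj G v u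
  ∖N⁻ U v () | false | _
  ∖N⁻ U v () | true  | true
  ... | true | false = refl , refl

  ∩-∖N : ∀ S U {v} → lookup S v ≡ false → ∀ u → (S ∩ (U ∖N[ v ])) u ≡ (S ∩ U) u ∧ not (adj G v u)
  ∩-∖N S U {v} v∉S u with v ≟ u
  ... | yes refl rewrite v∉S = refl
  ... | no _ = trans (cong (λ b → lookup S u ∧ U u ∧ b) (∧-identityʳ (not (adj G v u))))
                     (sym (∧-assoc (lookup S u) (U u) (not (adj G v u))))

  hits-∖N : ∀ S U {v} → lookup S v ≡ false → hits S U ≡ hits S (U ∖N[ v ]) + adjHits v S U
  hits-∖N S U {v} v∉S = begin-equality
    ∑[ u < n ] χ ((S ∩ U) u)
      ≡⟨ sum-cong-≗ (λ u → χ-split (adj G v u) ((S ∩ U) u)) ⟩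
    ∑[ u < n ] (χ ((S ∩ U) u ∧ not (adj G v u)) + χ (adj G v u ∧ (S ∩ U) u))
      ≡⟨ ∑-distrib-+ (λ u → χ ((S ∩ U) u ∧ not (adj G v u))) (λ u → χ (adj G v u ∧ (S ∩ U) u)) ⟩
    ∑[ u < n ] χ ((S ∩ U) u ∧ not (adj G v u)) + adjHits v S U
      ≡⟨ cong (_+ adjHits v S U) (sum-cong-≗ (λ u → cong χ (∩-∖N S U v∉S u))) ⟨
    hits S (U ∖N[ v ]) + adjHits v S U ∎
    where
    χ-split : ∀ a b → χ b ≡ χ (b ∧ not a) + χ (a ∧ b)
    χ-split true  true  = refl
    χ-split true  false = refl
    χ-split false true  = refl
    χ-split false false = refl

  misses-∖N : ∀ S U {v} → lookup S v ≡ false → misses S (U ∖N[ v ]) ≡ misses S U + adjHits v S U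
  misses-∖N S U {v} v∉S = +-cancelˡ-≡ (hits S (U ∖N[ v ])) _ _ (begin-equality
    h′ + misses S (U ∖N[ v ])  ≡⟨ size+size-not (S ∩ (U ∖N[ v ])) ⟩
    n                          ≡⟨ size+size-not (S ∩ U) ⟨
    hits S U + m               ≡⟨ cong (_+ m) (hits-∖N S U v∉S) ⟩
    h′ + j + m                 ≡⟨ solve 3 (λ h j m → h :+ j :+ m := h :+ (m :+ j)) refl h′ j m ⟩
    h′ + (m + j)               ∎)
    where
    h′ = hits S (U ∖N[ v ])
    m = misses S U
    j = adjHits v S U

  adjHits≤d : ∀ v S U → adjHits v S U ≤ d
  adjHits≤d v S U = ≤-trans (size-∧-≤ˡ (adj G v) (S ∩ U)) (subst (_≤ d) (degree≡size G v) (maxdeg v))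

  weight-∖N : ∀ S U {v} → lookup S v ≡ false → weight S (U ∖N[ v ]) * d ≤ weight S U * (d + adjHits v S U)
  weight-∖N S U {v} v∉S = begin
    p ^ h′ * q ^ misses S (U ∖N[ v ]) * d   ≡⟨ cong (λ e → p ^ h′ * q ^ e * d) (misses-∖N S U v∉S) ⟩
    p ^ h′ * q ^ (m + j) * d                ≡⟨ cong (λ x → p ^ h′ * x * d) (^-distribˡ-+-* q m j) ⟩
    p ^ h′ * (q ^ m * q ^ j) * d            ≡⟨ solve 4 (λ a b c d → a :* (b :* c) :* d := a :* b :* (c :* d)) refl (p ^ h′) (q ^ m) (q ^ j) d ⟩
    p ^ h′ * q ^ m * (q ^ j * d)            ≤⟨ *-monoʳ-≤ (p ^ h′ * q ^ m) ([1+2d]^j*d≤[2d]^j*[d+j] (adjHits≤d v S U)) ⟩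
    p ^ h′ * q ^ m * (p ^ j * (d + j))      ≡⟨ solve 4 (λ a b c d → a :* b :* (c :* d) := c :* a :* b :* d) refl (p ^ h′) (q ^ m) (p ^ j) (d + j) ⟩
    p ^ j * p ^ h′ * q ^ m * (d + j)        ≡⟨ cong (λ x → x * q ^ m * (d + j)) (^-distribˡ-+-* p j h′) ⟨
    p ^ (j + h′) * q ^ m * (d + j)          ≡⟨ cong (λ e → p ^ e * q ^ m * (d + j)) (trans (+-comm j h′) (sym (hits-∖N S U v∉S))) ⟩
    p ^ hits S U * q ^ m * (d + j)          ∎
    where
    h′ = hits S (U ∖N[ v ])
    m = misses S U
    j = adjHits v S U

  weight-average : ∀ S U → ∑[ v < n ] (χ (not (lookup S v) ∧ U v) * weight S (U ∖N[ v ])) ≤ size U * weight S U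
  weight-average S U = *-cancelʳ-≤ _ _ d (begin
    ∑[ v < n ] (χ (outside v) * weight S (U ∖N[ v ])) * d
      ≡⟨ *-distribʳ-sum d (λ v → χ (outside v) * weight S (U ∖N[ v ])) ⟩
    ∑[ v < n ] (χ (outside v) * weight S (U ∖N[ v ]) * d)
      ≤⟨ ∑-mono-≤ per-vertex ⟩
    ∑[ v < n ] (W * (χ (outside v) * d + adjHits v S U))
      ≡⟨ *-distribˡ-sum W (λ v → χ (outside v) * d + adjHits v S U) ⟨
    W * ∑[ v < n ] (χ (outside v) * d + adjHits v S U)
      ≡⟨ cong (W *_) (∑-distrib-+ (λ v → χ (outside v) * d) (λ v → adjHits v S U)) ⟩
    W * (∑[ v < n ] (χ (outside v) * d) + ∑[ v < n ] adjHits v S U)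
      ≤⟨ *-monoʳ-≤ W (+-monoʳ-≤ (∑[ v < n ] (χ (outside v) * d)) (∑-size-adj∧≤ G maxdeg (S ∩ U))) ⟩
    W * (∑[ v < n ] (χ (outside v) * d) + d * hits S U)
      ≡⟨ cong (λ x → W * (x + d * hits S U)) (*-distribʳ-sum d (χ ∘ outside)) ⟨
    W * (size outside * d + d * hits S U)
      ≡⟨ cong (W *_) (trans (cong (size outside * d +_) (*-comm d (hits S U))) (sym (*-distribʳ-+ d (size outside) (hits S U)))) ⟩
    W * ((size outside + hits S U) * d)
      ≡⟨ cong (λ x → W * (x * d)) (size-not∧+size-∧ U (lookup S)) ⟩
    W * (size U * d)
      ≡⟨ solve 3 (λ w s d → w :* (s :* d) := s :* w :* d) refl W (size U) d ⟩
    size U * W * d ∎)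
    where
    W = weight S U
    outside : Fin n → Bool
    outside v = not (lookup S v) ∧ U v
    per-vertex : ∀ v → χ (outside v) * weight S (U ∖N[ v ]) * d ≤ W * (χ (outside v) * d + adjHits v S U)
    per-vertex v with lookup S v in v∉S | U v
    ... | true  | _     = z≤n
    ... | false | false = z≤n
    ... | false | true  = begin
      (weight S (U ∖N[ v ]) + 0) * d  ≡⟨ cong (_* d) (+-identityʳ (weight S (U ∖N[ v ]))) ⟩
      weight S (U ∖N[ v ]) * d        ≤⟨ weight-∖N S U v∉S ⟩
      W * (d + adjHits v S U)         ≡⟨ cong (λ x → W * (x + adjHits v S U)) (+-identityʳ d) ⟨
      W * (d + 0 + adjHits v S U)     ∎

  potential-survivors : ∀ U v F →
    potential (U ∖N[ v ]) (survivors v F) ≡ sum (map (λ S → χ (not (lookup S v)) * weight S (U ∖N[ v ])) F)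
  potential-survivors U v F = sum-map-filterᵇ (λ S → not (lookup S v)) (λ S → weight S (U ∖N[ v ])) F

  potential-average : ∀ U F → ∑[ v < n ] (χ (U v) * potential (U ∖N[ v ]) (survivors v F)) ≤ size U * potential U F
  potential-average U F = begin
    ∑[ v < n ] (χ (U v) * potential (U ∖N[ v ]) (survivors v F))
      ≡⟨ sum-cong-≗ (λ v → trans (cong (χ (U v) *_) (potential-survivors U v F)) (sym (sum-map-*ˡ (χ (U v)) _ F))) ⟩
    ∑[ v < n ] sum (map (λ S → χ (U v) * (χ (not (lookup S v)) * weight S (U ∖N[ v ]))) F)
      ≡⟨ ∑-sum-map-comm (λ v S → χ (U v) * (χ (not (lookup S v)) * weight S (U ∖N[ v ]))) F ⟩
    sum (map (λ S → ∑[ v < n ] (χ (U v) * (χ (not (lookup S v)) * weight S (U ∖N[ v ])))) F)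
      ≡⟨ cong sum (map-cong (λ S → sum-cong-≗ (λ v → regroup (U v) (lookup S v) (weight S (U ∖N[ v ])))) F) ⟩
    sum (map (λ S → ∑[ v < n ] (χ (not (lookup S v) ∧ U v) * weight S (U ∖N[ v ]))) F)
      ≤⟨ sum-map-mono-≤ F (λ {S} _ → weight-average S U) ⟩
    sum (map (λ S → size U * weight S U) F)
      ≡⟨ sum-map-*ˡ (size U) (λ S → weight S U) F ⟩
    size U * potential U F ∎
    where
    regroup : ∀ u s w → χ u * (χ (not s) * w) ≡ χ (not s ∧ u) * w
    regroup u s w = trans (solve 3 (λ x y z → x :* (y :* z) := y :* x :* z) refl (χ u) (χ (not s)) w)
                          (cong (_* w) (sym (χ-∧ (not s) u)))

  greedy-step : ∀ U F → 0 < size U → ∃ λ v → U v ≡ true × potential (U ∖N[ v ]) (survivors v F) ≤ potential U F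
  greedy-step U F 0<size = ∃-below-average U (λ v → potential (U ∖N[ v ]) (survivors v F)) (potential U F)
                                           0<size (potential-average U F)

  -- A set disjoint from U has weight q ^ n on its own.
  potential<q^n⇒0<size : ∀ U S F → potential U (S ∷ F) < q ^ n → 0 < size U
  potential<q^n⇒0<size U S F Φ<q^n = ≰⇒> λ size≤0 → <⇒≱ Φ<q^n (begin
    q ^ n                        ≡⟨ cong (q ^_) (size+size-not (S ∩ U)) ⟨
    q ^ (hits S U + misses S U)  ≡⟨ cong (λ h → q ^ (h + misses S U)) (no-hits size≤0) ⟩
    q ^ misses S U               ≡⟨ +-identityʳ (q ^ misses S U) ⟨
    p ^ 0 * q ^ misses S U       ≡⟨ cong (λ h → p ^ h * q ^ misses S U) (no-hits size≤0) ⟨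
    weight S U                   ≤⟨ m≤m+n (weight S U) (potential U F) ⟩
    potential U (S ∷ F)          ∎)
    where
    no-hits : size U ≤ 0 → hits S U ≡ 0
    no-hits size≤0 = n≤0⇒n≡0 (≤-trans (size-∧-≤ʳ (lookup S) U) size≤0)

  size-∖N< : ∀ U {v} → U v ≡ true → size (U ∖N[ v ]) < size U
  size-∖N< U {v} Uv = size-∧-<ˡ U (λ u → not (adj G v u) ∧ not (does (v ≟ u))) Uv
    (trans (cong (λ b → not (adj G v v) ∧ not b) (dec-true (v ≟ v) refl)) (∧-zeroʳ (not (adj G v v))))

  Transversal : (Fin n → Bool) → List (Subset n) → Set
  Transversal U F = ∃ λ I → (∀ {u} → u ∈ I → U u ≡ true) × Independent G I × (∀ S → S ∈ₗ F → Meets I S)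

  add-vertex : ∀ U {v} F → U v ≡ true → Transversal (U ∖N[ v ]) (survivors v F) → Transversal U F
  add-vertex U {v} F Uv (I , I⊆U∖N , indep , meets) = I ∪ ⁅ v ⁆ , I+v⊆U , indep′ , meets′
    where
    split : ∀ {u} → u ∈ I ∪ ⁅ v ⁆ → u ∈ I ⊎ u ≡ v
    split u∈ = map₂ (x∈⁅y⁆⇒x≡y v) (x∈p∪q⁻ I ⁅ v ⁆ u∈)
    I+v⊆U : ∀ {u} → u ∈ I ∪ ⁅ v ⁆ → U u ≡ true
    I+v⊆U u∈ with split u∈
    ... | inj₁ u∈I = proj₁ (∖N⁻ U v (I⊆U∖N u∈I))
    ... | inj₂ refl = Uv
    indep′ : Independent G (I ∪ ⁅ v ⁆)
    indep′ u w u∈ w∈ with split u∈ | split w∈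
    ... | inj₁ u∈I | inj₁ w∈I = indep u w u∈I w∈I
    ... | inj₁ u∈I | inj₂ refl = trans (Graph.sym G u v) (proj₂ (∖N⁻ U v (I⊆U∖N u∈I)))
    ... | inj₂ refl | inj₁ w∈I = proj₂ (∖N⁻ U v (I⊆U∖N w∈I))
    ... | inj₂ refl | inj₂ refl = irref G v
    meets′ : ∀ S → S ∈ₗ F → Meets (I ∪ ⁅ v ⁆) S
    meets′ S S∈F with lookup S v in Sv
    ... | true  = v , lookup⇒[]= v S Sv , x∈p∪q⁺ (inj₂ (x∈⁅x⁆ v))
    ... | false with meets S (∈-filter⁺ (T? ∘ λ S → not (lookup S v)) S∈F (subst (T ∘ not) (sym Sv) _))
    ...   | w , w∈S , w∈I = w , w∈S , x∈p∪q⁺ (inj₁ w∈I)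

  greedy : ∀ fuel U F → size U ≤ fuel → potential U F < q ^ n → Transversal U F
  greedy _ U [] _ _ = ⊥ , (λ u∈⊥ → contradiction u∈⊥ ∉⊥) , (λ _ _ u∈⊥ _ → contradiction u∈⊥ ∉⊥) , (λ _ ())
  greedy zero U (S ∷ F) size≤0 Φ<q^n = contradiction (potential<q^n⇒0<size U S F Φ<q^n) (≤⇒≯ size≤0)
  greedy (suc fuel) U F@(S ∷ F′) size≤1+fuel Φ<q^n with greedy-step U F (potential<q^n⇒0<size U S F′ Φ<q^n)
  ... | v , Uv , Φ′≤Φ = add-vertex U F Uv (greedy fuel (U ∖N[ v ]) (survivors v F)
                          (≤-pred (≤-trans (size-∖N< U Uv) size≤1+fuel)) (≤-<-trans Φ′≤Φ Φ<q^n))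

  potential-everything< : ∀ {k} F → (∀ S → S ∈ₗ F → k ≤ ∣ S ∣) → length F * p ^ k < q ^ k →
    potential everything F < q ^ n
  potential-everything< {k} F large few = *-cancelʳ-< (q ^ k) (potential everything F) (q ^ n) (begin-strict
    potential everything F * q ^ k                    ≡⟨ *-comm (potential everything F) (q ^ k) ⟩
    q ^ k * potential everything F                    ≡⟨ sum-map-*ˡ (q ^ k) (λ S → weight S everything) F ⟨
    sum (map (λ S → q ^ k * weight S everything) F)   ≤⟨ sum-map-mono-≤ F (λ {S} S∈F → weight-bound S (large S S∈F)) ⟩
    sum (map (λ _ → p ^ k * q ^ n) F)                 ≡⟨ sum-map-const F (p ^ k * q ^ n) ⟩
    length F * (p ^ k * q ^ n)                        ≡⟨ *-assoc (length F) (p ^ k) (q ^ n) ⟨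
    length F * p ^ k * q ^ n                          <⟨ *-monoˡ-< (q ^ n) {{m^n≢0 q n}} few ⟩
    q ^ k * q ^ n                                     ≡⟨ *-comm (q ^ k) (q ^ n) ⟩
    q ^ n * q ^ k                                     ∎)
    where
    hits-all : ∀ S → hits S everything ≡ ∣ S ∣
    hits-all S = trans (sum-cong-≗ (λ u → cong χ (∧-identityʳ (lookup S u)))) (sym (∣p∣≡size S))
    weight-bound : ∀ S → k ≤ ∣ S ∣ → q ^ k * weight S everything ≤ p ^ k * q ^ n
    weight-bound S k≤∣S∣ = begin
      q ^ k * (p ^ h * q ^ m)   ≡⟨ solve 3 (λ a b c → a :* (b :* c) := b :* a :* c) refl (q ^ k) (p ^ h) (q ^ m) ⟩
      p ^ h * q ^ k * q ^ m     ≤⟨ *-monoˡ-≤ (q ^ m) (a^h*b^k≤a^k*b^h (n≤1+n p) (subst (k ≤_) (sym (hits-all S)) k≤∣S∣)) ⟩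
      p ^ k * q ^ h * q ^ m     ≡⟨ *-assoc (p ^ k) (q ^ h) (q ^ m) ⟩
      p ^ k * (q ^ h * q ^ m)   ≡⟨ cong (p ^ k *_) (^-distribˡ-+-* q h m) ⟨
      p ^ k * q ^ (h + m)       ≡⟨ cong (λ e → p ^ k * q ^ e) (size+size-not (S ∩ everything)) ⟩
      p ^ k * q ^ n             ∎
      where
      h = hits S everything
      m = misses S everything

  independent-transversal : ∀ {k} F → (∀ S → S ∈ₗ F → k ≤ ∣ S ∣) → length F * p ^ k < q ^ k →
    ∃ λ I → Independent G I × (∀ S → S ∈ₗ F → Meets I S)
  independent-transversal F large few =
    let I , _ , indep , meets = greedy (size everything) everything F ≤-refl (potential-everything< F large few)
    in I , indep , meets

lemma13 : ∀ {n : ℕ} (G : Graph n) (d k : ℕ) (F : List (Subset n))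
          → 1 ≤ d
          → MaxDegree≤ G d
          → Unique F
          → (∀ S → S ∈ₗ F → k ≤ ∣ S ∣)
          → ≤Exp (6 * length F) k (6 * d)
          → ∃ λ I → Independent G I × (∀ S → S ∈ₗ F → Meets I S)
lemma13 G d k F 1≤d maxdeg _ large small =
  Greedy.independent-transversal G d maxdeg F large (≤Exp⇒*^<^ (length F) k d small)
  where instance _ = >-nonZero 1≤d
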